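{- Given a flat counter system $S=\langle Q,\mathtt{C}_n,\Delta,\mathbf{l}\rangle$ and a configuration $c_0$, there is a finite set $X$ of minimal path schemas of $S$ with $|X|\le|\Delta|^{2|\Delta|}$ such that $\mathrm{Lab}(c_0)=\mathrm{Lab}\big(\bigcup_{P\in X}P,\,c_0\big)$.
   Context: A counter system has finite control states $Q$ and finite transitions $\Delta\subseteq Q\times\mathrm{Guards}\times\mathbb{Z}^n\times Q$; configurations are in $Q\times\mathbb{N}^n$ and $(q,\vec v)\xrightarrow{\delta}(q',\vec v')$ iff $\delta=(q,\mathtt{g},\vec u,q')$, $\vec v$ satisfies $\mathtt{g}$ and $\vec v'=\vec v+\vec u$; flat means each state lies on at most one simple cycle. An $\omega$-word $w\in\Delta^\omega$ is fireable from $c_0$ if every finite prefix of $w$ leads from $c_0$ to some configuration; $\mathrm{Lab}(c_0)$ is the set of such words. For an $\omega$-regular expression $E$ over $\Delta$, $\mathrm{Lab}(E,c_0)$ is the set of transition words of infinite runs from $c_0$ lying in the language of $E$. A path segment is a finite sequence of transitions with consecutive matching states; simple if nonempty with no repeated transition; a loop is a simple path segment whose first and last states coincide. A path schema is $P=p_1l_1^+\cdots p_kl_k^\omega$ with $l_i$ loops and $p_1l_1\cdots p_kl_k$ a path segment; it is minimal if $p_1\cdots p_k$ is empty or a simple non-loop segment, and the $l_i$ have pairwise disjoint transition sets. -}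

module Defs where

open import Data.Nat using (ℕ; zero; suc; _+_; _*_; _≤_; _≥_)
open import Data.Integer as ℤ using (ℤ; +_)
open import Data.Fin using (Fin; toℕ)
open import Data.Vec as Vec using (Vec)
open import Data.List as List using (List; []; _∷_; _++_; length; concat; replicate; map; applyUpTo; lookup)
open import Data.List.Relation.Unary.Linked using (Linked)
open import Data.List.Relation.Unary.Unique.Propositional using (Unique)
open import Data.List.Relation.Unary.All using (All)
open import Data.List.Relation.Unary.AllPairs using (AllPairs)
open import Data.List.Membership.Propositional using (_∈_; _∉_)
open import Data.Product using (Σ; ∃; ∃₂; _×_; _,_)
open import Data.Empty using (⊥)
open import Data.Unit using (⊤)
open import Data.Sum using (_⊎_)
open import Relation.Nullary using (¬_)
open import Relation.Binary.PropositionalEquality using (_≡_; _≢_)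

data Guard (n : ℕ) : Set where
  gtrue : Guard n
  atom  : Vec ℤ n → ℤ → Guard n
  gnot  : Guard n → Guard n
  gand  : Guard n → Guard n → Guard n
  gor   : Guard n → Guard n → Guard n

dot : ∀ {n} → Vec ℤ n → Vec ℕ n → ℤ
dot a v = Vec.foldr _ ℤ._+_ (+ 0) (Vec.zipWith (λ x y → x ℤ.* (+ y)) a v)

Sat : ∀ {n} → Guard n → Vec ℕ n → Set
Sat gtrue      v = ⊤
Sat (atom a b) v = dot a v ℤ.≤ b
Sat (gnot g)   v = ¬ Sat g v
Sat (gand g h) v = Sat g v × Sat h v
Sat (gor g h)  v = Sat g v ⊎ Sat h v

-- Counter systems with n counters.
-- States are Fin nQ, transitions are Fin nΔ (so |Δ| = nΔ); transition
-- δ = (src δ, guard δ, upd δ, tgt δ).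

record CounterSystem (n : ℕ) : Set where
  field
    nQ    : ℕ
    nΔ    : ℕ
    src   : Fin nΔ → Fin nQ
    guard : Fin nΔ → Guard n
    upd   : Fin nΔ → Vec ℤ n
    tgt   : Fin nΔ → Fin nQ

module _ {n : ℕ} (S : CounterSystem n) where
  open CounterSystem S

  T : Set
  T = Fin nΔ

  Conf : Set
  Conf = Fin nQ × Vec ℕ n

  Step : Conf → T → Conf → Set
  Step (q , v) δ (q' , v') =
    src δ ≡ q × Sat (guard δ) v ×
    Vec.map +_ v' ≡ Vec.zipWith ℤ._+_ (Vec.map +_ v) (upd δ) × tgt δ ≡ q'

  data Run : Conf → List T → Conf → Set where
    run-nil  : ∀ {c} → Run c [] c
    run-cons : ∀ {c c' c'' δ ws} → Step c δ c' → Run c' ws c'' → Run c (δ ∷ ws) c''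

  prefix : ℕ → (ℕ → T) → List T
  prefix k w = applyUpTo w k

  -- w ∈ Lab(c₀): every finite prefix of w is fireable from c₀
  Fireable : Conf → (ℕ → T) → Set
  Fireable c₀ w = ∀ k → ∃ λ c → Run c₀ (prefix k w) c

  lastOf : T → List T → T
  lastOf t []       = t
  lastOf t (u ∷ us) = lastOf u us

  Consecutive : List T → Set
  Consecutive = Linked (λ t t' → tgt t ≡ src t')

  IsSimple : List T → Set
  IsSimple []       = ⊥
  IsSimple (t ∷ ts) = Consecutive (t ∷ ts) × Unique (t ∷ ts)

  IsLoop : List T → Set
  IsLoop []       = ⊥
  IsLoop (t ∷ ts) = IsSimple (t ∷ ts) × src t ≡ tgt (lastOf t ts)

  IsSimpleNonLoop : List T → Set
  IsSimpleNonLoop []       = ⊥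
  IsSimpleNonLoop (t ∷ ts) = IsSimple (t ∷ ts) × src t ≢ tgt (lastOf t ts)

  IsSimpleCycle : List T → Set
  IsSimpleCycle []       = ⊥
  IsSimpleCycle (t ∷ ts) =
    Consecutive (t ∷ ts) × src t ≡ tgt (lastOf t ts) × Unique (map src (t ∷ ts))

  -- flat: each state lies on at most one simple cycle (up to rotation)
  Flat : Set
  Flat = ∀ (q : Fin nQ) (c c' : List T) →
    IsSimpleCycle c → IsSimpleCycle c' → q ∈ map src c → q ∈ map src c' →
    ∃₂ λ a b → c ≡ a ++ b × c' ≡ b ++ a

  -- path schemas  P = p₁ l₁⁺ ⋯ p_{k-1} l_{k-1}⁺ p_k l_k^ω

  record PathSchema : Set where
    constructor schema
    field
      body : List (List T × List T)   -- (pᵢ , lᵢ) for i < k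
      pk   : List T
      lk   : List T

  open PathSchema public

  flatPairs : List (List T × List T) → List T
  flatPairs []             = []
  flatPairs ((p , l) ∷ ps) = p ++ l ++ flatPairs ps

  skeleton : PathSchema → List T
  skeleton P = flatPairs (body P) ++ pk P ++ lk P

  loops : PathSchema → List (List T)
  loops P = map (λ pl → Data.Product.proj₂ pl) (body P) ++ (lk P ∷ [])

  stems : PathSchema → List T
  stems P = concat (map (λ pl → Data.Product.proj₁ pl) (body P)) ++ pk P

  IsPathSchema : PathSchema → Set
  IsPathSchema P = All IsLoop (loops P) × Consecutive (skeleton P)

  Disjoint : List T → List T → Set
  Disjoint l l' = ∀ {t} → t ∈ l → t ∉ l'

  IsMinimal : PathSchema → Set
  IsMinimal P = IsPathSchema P
              × (stems P ≡ [] ⊎ IsSimpleNonLoop (stems P))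
              × AllPairs Disjoint (loops P)

  StartsWith : List T → (ℕ → T) → Set
  StartsWith u w = ∀ (i : Fin (length u)) → w (toℕ i) ≡ lookup u i

  shift : ℕ → (ℕ → T) → (ℕ → T)
  shift k w i = w (k + i)

  rep : ℕ → List T → List T
  rep m l = concat (replicate m l)

  InLang : List (List T × List T) → List T → List T → (ℕ → T) → Set
  InLang [] p l w =
    StartsWith p w × (∀ m → StartsWith l (shift (length p + m * length l) w))
  InLang ((p₁ , l₁) ∷ ps) p l w =
    Σ ℕ λ m → m ≥ 1 × StartsWith (p₁ ++ rep m l₁) w
            × InLang ps p l (shift (length (p₁ ++ rep m l₁)) w)

  _∈L_ : (ℕ → T) → PathSchema → Set
  w ∈L P = InLang (body P) (pk P) (lk P) w

-- A fireable word w traces an infinite path in the control graph.  Call a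
-- position L a last visit if the state there never occurs again.  Starting at
-- position 0, jump to the last visit L of the current state and continue at
-- L + 1, until a state is reached that recurs forever.  In a flat system every
-- nonempty closed walk at q is a power of the unique simple cycle at q
-- (closedWalk-power), so between a position and its last visit w runs around
-- the cycle of that state, and after the final recurrent state w is periodic
-- with its cycle.  The transitions w(L) leaving states for good form a simple
-- non-loop segment, and the cycles used are pairwise disjoint (flatness
-- again), so w lies in the language of a minimal path schema.  That schema is
-- rebuilt by a decoder from two sets of transitions: the leaving ones, and
-- those preceded by a cycle.  Coding each set by a vector in Δ^|Δ| gives
-- |Δ|^(2|Δ|) candidate schemas; X consists of the minimal ones.  Excluded
-- middle is used to choose cycles, last visits and codes.

module Submission where

open import Defs
open import Level using (0ℓ)
open import Axiom.ExcludedMiddle using (ExcludedMiddle)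
open import Data.Bool using (Bool; true; false; not)
open import Data.Empty using (⊥-elim)
open import Data.Fin as F using (Fin; toℕ)
import Data.Fin.Properties as FP
open import Data.List as L using (List; []; _∷_; _++_; map; concat; replicate; length; cartesianProductWith)
import Data.List.Properties as LP
open import Data.List.Membership.Propositional using (_∈_; find; lose)
open import Data.List.Membership.Propositional.Properties
  using (∈-map⁺; ∈-map⁻; ∈-++⁺ˡ; ∈-++⁺ʳ; ∈-++⁻; ∈-lookup; ∈-∃++; ∈-allFin; ∈-AllPairs₂;
         ∈-cartesianProductWith⁺; ∈-filter⁺)
open import Data.List.Relation.Unary.All as All using (All; []; _∷_)
import Data.List.Relation.Unary.All.Properties as AllP
import Data.List.Relation.Unary.Any.Properties as AnyP
open import Data.List.Relation.Unary.Any as Any using (Any; here; there)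
open import Data.List.Relation.Unary.AllPairs using (AllPairs; []; _∷_)
import Data.List.Relation.Unary.AllPairs.Properties as APP
open import Data.List.Relation.Unary.Linked using ([]; [-]; _∷_)
open import Data.List.Relation.Unary.Unique.Propositional using (Unique)
import Data.List.Relation.Unary.Unique.Propositional.Properties as UP
open import Data.Maybe using (Maybe; just; nothing)
open import Data.Nat as N using (ℕ; zero; suc; _+_; _*_; _^_; _≤_; _<_; z≤n; s≤s)
import Data.Nat.Properties as NP
open import Data.Nat.Tactic.RingSolver using (solve-∀)
open import Data.Product using (Σ; ∃; ∃₂; _×_; _,_; proj₁; proj₂)
open import Data.Sum using (_⊎_; inj₁; inj₂)
open import Data.Vec as V using (Vec)
import Data.Vec.Properties as VP
open import Function.Base using (_∘_)
open import Function.Bundles using (_⇔_; mk⇔; Equivalence)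
open import Relation.Nullary using (¬_; Dec; yes; no; does)
open import Relation.Binary.PropositionalEquality

module ListFacts {A : Set} where

  ++-compare : ∀ (X Z C R : List A) → X ++ Z ≡ C ++ R →
    (∃ λ M → X ≡ C ++ M × R ≡ M ++ Z) ⊎ (∃₂ λ y M → C ≡ X ++ y ∷ M × Z ≡ y ∷ M ++ R)
  ++-compare X       Z []      R eq = inj₁ (X , refl , sym eq)
  ++-compare []      Z (c ∷ C) R eq = inj₂ (c , C , refl , eq)
  ++-compare (x ∷ X) Z (c ∷ C) R eq with refl , eq′ ← LP.∷-injective eq
    with ++-compare X Z C R eq′
  ... | inj₁ (M , e₁ , e₂)     = inj₁ (M , cong (x ∷_) e₁ , e₂)
  ... | inj₂ (y , M , e₁ , e₂) = inj₂ (y , M , cong (x ∷_) e₁ , e₂)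

  ∈-power : ∀ {x} m (C : List A) → x ∈ concat (replicate m C) → x ∈ C
  ∈-power (suc m) C x∈ with ∈-++⁻ C x∈
  ... | inj₁ x∈C = x∈C
  ... | inj₂ x∈Cᵐ = ∈-power m C x∈Cᵐ

  ++-cancel-length : ∀ (xs ys : List A) {xs′ ys′ : List A} →
    length xs ≡ length ys → xs ++ xs′ ≡ ys ++ ys′ → xs ≡ ys
  ++-cancel-length []       []       _  _  = refl
  ++-cancel-length (x ∷ xs) (y ∷ ys) le eq with refl , eq′ ← LP.∷-injective eq =
    cong (x ∷_) (++-cancel-length xs ys (NP.suc-injective le) eq′)

  length-pos : ∀ {xs : List A} → xs ≢ [] → 0 < length xs
  length-pos {[]}    xs≢[] = ⊥-elim (xs≢[] refl)
  length-pos {x ∷ xs} _    = s≤s z≤n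

  ++-nonempty : ∀ (xs : List A) {ys} → ys ≢ [] → xs ++ ys ≢ []
  ++-nonempty xs ys≢[] eq = ys≢[] (LP.++-conicalʳ xs _ eq)

  power-nonempty : ∀ k {C : List A} → concat (replicate (suc k) C) ≢ [] → C ≢ []
  power-nonempty k Cᵏ⁺¹≢[] refl = Cᵏ⁺¹≢[] (powers-of-[] k)
    where powers-of-[] : ∀ k → concat (replicate k []) ≡ []
          powers-of-[] zero    = refl
          powers-of-[] (suc k) = powers-of-[] k

open ListFacts

unique-length≤ : ∀ {m} (xs : List (Fin m)) → Unique xs → length xs ≤ m
unique-length≤ {m} xs u with m N.<? length xs
... | no m≮len = NP.≮⇒≥ m≮len
... | yes m<len with i , j , i<j , eq ← FP.pigeonhole m<len (L.lookup xs) =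
  ⊥-elim (distinct xs u i j i<j eq)
  where
  distinct : ∀ ys → Unique ys → ∀ i j → i F.< j → L.lookup ys i ≢ L.lookup ys j
  distinct (y ∷ ys) (y∉ ∷ _) F.zero    (F.suc j) _         = All.lookup y∉ (∈-lookup j)
  distinct (y ∷ ys) (_ ∷ u) (F.suc i) (F.suc j) (s≤s i<j) = distinct ys u i j i<j

module Vectors {A : Set} where

  vectors : List A → (k : ℕ) → List (Vec A k)
  vectors xs zero    = V.[] ∷ []
  vectors xs (suc k) = cartesianProductWith V._∷_ xs (vectors xs k)

  length-cartesianProductWith : ∀ {B C : Set} (f : A → B → C) xs ys →
    length (cartesianProductWith f xs ys) ≡ length xs * length ys
  length-cartesianProductWith f []       ys = refl
  length-cartesianProductWith f (x ∷ xs) ys = begin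
    length (map (f x) ys ++ cartesianProductWith f xs ys)
      ≡⟨ LP.length-++ (map (f x) ys) ⟩
    length (map (f x) ys) + length (cartesianProductWith f xs ys)
      ≡⟨ cong₂ _+_ (LP.length-map (f x) ys) (length-cartesianProductWith f xs ys) ⟩
    length ys + length xs * length ys ∎
    where open ≡-Reasoning

  length-vectors : ∀ xs k → length (vectors xs k) ≡ length xs ^ k
  length-vectors xs zero    = refl
  length-vectors xs (suc k) =
    trans (length-cartesianProductWith V._∷_ xs (vectors xs k))
          (cong (length xs *_) (length-vectors xs k))

  ∈-vectors : ∀ xs {k} (v : Vec A k) → (∀ i → V.lookup v i ∈ xs) → v ∈ vectors xs k
  ∈-vectors xs V.[]       _ = here refl
  ∈-vectors xs (x V.∷ v) h =
    ∈-cartesianProductWith⁺ V._∷_ (h F.zero) (∈-vectors xs v (λ i → h (F.suc i)))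

open Vectors

-- A vector c : Vec (Fin m) m codes the subset {i | c[i] ≢ i} of Fin m.
-- Classically, every subset whose members all have some other index beside
-- them is coded by a vector; this is how a pair of subsets of Δ is encoded
-- in |Δ|^(2|Δ|) codes.
module SubsetCodes (em : ExcludedMiddle 0ℓ) {m : ℕ} where

  _∈ᶜ_ : Fin m → Vec (Fin m) m → Bool
  i ∈ᶜ c = not (does (V.lookup c i F.≟ i))

  module _ (P : Fin m → Set) (other : ∀ i → P i → ∃ λ j → j ≢ i) where

    codeEntry : Fin m → Fin m
    codeEntry i with em {P i}
    ... | yes p = proj₁ (other i p)
    ... | no _  = i

    code : Vec (Fin m) m
    code = V.tabulate codeEntry

    code-correct : ∀ i → i ∈ᶜ code ≡ true ⇔ P i
    code-correct i rewrite VP.lookup∘tabulate codeEntry i = mk⇔ to from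
      where
      to : not (does (codeEntry i F.≟ i)) ≡ true → P i
      to h with em {P i}
      ... | yes p = p
      ... | no _ with i F.≟ i
      to () | no _ | yes _
      to h  | no _ | no i≢i = ⊥-elim (i≢i refl)
      from : P i → not (does (codeEntry i F.≟ i)) ≡ true
      from p with em {P i}
      ... | no ¬p = ⊥-elim (¬p p)
      ... | yes p′ with proj₁ (other i p′) F.≟ i
      ...   | yes eq = ⊥-elim (proj₂ (other i p′) eq)
      ...   | no _   = refl

module Walks {n : ℕ} (S : CounterSystem n) where
  open CounterSystem S
  open import Data.List.Membership.DecPropositional (F._≟_ {nQ}) using (_∈?_)

  data Walk : Fin nQ → List (Fin nΔ) → Fin nQ → Set where
    wnil  : ∀ {q} → Walk q [] q
    wcons : ∀ {q t ts r} → src t ≡ q → Walk (tgt t) ts r → Walk q (t ∷ ts) r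

  walk-++ : ∀ {q r r′ xs ys} → Walk q xs r → Walk r ys r′ → Walk q (xs ++ ys) r′
  walk-++ wnil         w₂ = w₂
  walk-++ (wcons e w₁) w₂ = wcons e (walk-++ w₁ w₂)

  walk-++⁻ : ∀ {q r′ ys} xs → Walk q (xs ++ ys) r′ → ∃ λ r → Walk q xs r × Walk r ys r′
  walk-++⁻ []       w = _ , wnil , w
  walk-++⁻ (x ∷ xs) (wcons e w) with r , w₁ , w₂ ← walk-++⁻ xs w = r , wcons e w₁ , w₂

  walk-end-unique : ∀ {q r r′ xs} → Walk q xs r → Walk q xs r′ → r ≡ r′
  walk-end-unique wnil        wnil         = refl
  walk-end-unique (wcons _ w) (wcons _ w′) = walk-end-unique w w′

  walk-consecutive : ∀ {q r xs} → Walk q xs r → Consecutive S xs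
  walk-consecutive wnil                     = []
  walk-consecutive (wcons e wnil)           = [-]
  walk-consecutive (wcons e (wcons e′ w))   = sym e′ ∷ walk-consecutive (wcons e′ w)

  walk-last : ∀ {q r t ts} → Walk q (t ∷ ts) r → tgt (lastOf S t ts) ≡ r
  walk-last (wcons e wnil)         = refl
  walk-last (wcons e (wcons e′ w)) = walk-last (wcons e′ w)

  record Detour (q : Fin nQ) (W : List (Fin nΔ)) (r : Fin nQ) : Set where
    constructor detour
    field
      {X Y Z} : List (Fin nΔ)
      {p}     : Fin nQ
      split   : W ≡ X ++ Y ++ Z
      walkX   : Walk q X p
      walkY   : Walk p Y p
      walkZ   : Walk p Z r
      Y≢[]    : Y ≢ []
      Z≢[]    : Z ≢ []

  distinct-or-detour : ∀ {q r} W → Walk q W r → Unique (map src W) ⊎ Detour q W r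
  distinct-or-detour []      wnil        = inj₁ []
  distinct-or-detour (t ∷ W) (wcons e w) with src t ∈? map src W
  ... | yes src-t∈
    with t′ , t′∈W , src-t≡ ← ∈-map⁻ src src-t∈
    with Y′ , Z′ , refl ← ∈-∃++ t′∈W
    with _ , wY′ , wcons e′ wZ′ ← walk-++⁻ Y′ w =
    inj₂ (detour {X = []} refl wnil
            (wcons e (subst (Walk (tgt t) Y′) (trans (sym e′) (trans (sym src-t≡) e)) wY′))
            (wcons (trans (sym src-t≡) e) wZ′)
            (λ ()) (λ ()))
  ... | no src-t∉ with distinct-or-detour W w
  ...   | inj₁ u = inj₁ (AllP.¬Any⇒All¬ (map src W) src-t∉ ∷ u)
  ...   | inj₂ (detour refl wX wY wZ Y≢[] Z≢[]) =
    inj₂ (detour refl (wcons e wX) wY wZ Y≢[] Z≢[])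

  unique-position : ∀ P P′ x x′ Q Q′ → P ++ x ∷ Q ≡ P′ ++ x′ ∷ Q′ → src x ≡ src x′ →
                    Unique (map src (P ++ x ∷ Q)) → P ≡ P′
  unique-position []      []       x x′ Q Q′ eq e u = refl
  unique-position []      (y ∷ P′) x x′ Q Q′ eq e (x∉ ∷ _) with refl , eq′ ← LP.∷-injective eq =
    ⊥-elim (All.lookup x∉ (subst (λ l → src x′ ∈ map src l) (sym eq′) (∈-map⁺ src (∈-++⁺ʳ P′ (here refl)))) e)
  unique-position (y ∷ P) []       x x′ Q Q′ eq e (y∉ ∷ _) with refl , _ ← LP.∷-injective eq =
    ⊥-elim (All.lookup y∉ (∈-map⁺ src (∈-++⁺ʳ P (here refl))) (sym e))
  unique-position (y ∷ P) (y′ ∷ P′) x x′ Q Q′ eq e (_ ∷ u) with refl , eq′ ← LP.∷-injective eq =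
    cong (y ∷_) (unique-position P P′ x x′ Q Q′ eq′ e u)

  prefix-unique : ∀ {q p C} X X′ y y′ M M′ → Unique (map src C) → Walk q C q →
                  C ≡ X ++ y ∷ M → C ≡ X′ ++ y′ ∷ M′ → Walk q X p → Walk q X′ p → X ≡ X′
  prefix-unique {q} X X′ y y′ M M′ u w C≡ C≡′ wX wX′
    with _ , wX₁ , wcons ey _ ← walk-++⁻ X (subst (λ l → Walk q l q) C≡ w)
       | _ , wX₁′ , wcons ey′ _ ← walk-++⁻ X′ (subst (λ l → Walk q l q) C≡′ w)
    with refl ← walk-end-unique wX₁ wX | refl ← walk-end-unique wX₁′ wX′ =
    unique-position X X′ y y′ M M′ (trans (sym C≡) C≡′) (trans ey (sym ey′))
                    (subst (λ l → Unique (map src l)) C≡ u)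

module Cycles {n : ℕ} (S : CounterSystem n) (em : ExcludedMiddle 0ℓ) (flat : Flat S) where
  open CounterSystem S
  open Walks S

  SimpleCycleAt : Fin nQ → List (Fin nΔ) → Set
  SimpleCycleAt q C = Walk q C q × Unique (map src C) × C ≢ []

  simpleCycle-isSimpleCycle : ∀ {q C} → SimpleCycleAt q C → IsSimpleCycle S C
  simpleCycle-isSimpleCycle {C = []}     (_ , _ , C≢[]) = C≢[] refl
  simpleCycle-isSimpleCycle {C = t ∷ ts} (w@(wcons e _) , u , _) =
    walk-consecutive w , trans e (sym (walk-last w)) , u

  simpleCycle-isLoop : ∀ {q C} → SimpleCycleAt q C → IsLoop S C
  simpleCycle-isLoop {C = []}     (_ , _ , C≢[]) = C≢[] refl
  simpleCycle-isLoop {C = t ∷ ts} (w@(wcons e _) , u , _) =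
    (walk-consecutive w , UP.map⁻ u) , trans e (sym (walk-last w))

  simpleCycle-∈ : ∀ {q C} → SimpleCycleAt q C → q ∈ map src C
  simpleCycle-∈ {C = []}     (_ , _ , C≢[]) = ⊥-elim (C≢[] refl)
  simpleCycle-∈ {C = t ∷ ts} (wcons e _ , _ , _) = here (sym e)

  -- There is at most one simple cycle at each state: by flatness two simple
  -- cycles at q are rotations of each other, and a nontrivial rotation would
  -- repeat the source q.
  simpleCycle-unique : ∀ {q C C′} → SimpleCycleAt q C → SimpleCycleAt q C′ → C ≡ C′
  simpleCycle-unique {q} {C} {C′} sc sc′
    with flat q C C′ (simpleCycle-isSimpleCycle sc) (simpleCycle-isSimpleCycle sc′)
              (simpleCycle-∈ sc) (simpleCycle-∈ sc′)
  ... | [] , b , refl , refl = sym (LP.++-identityʳ b)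
  ... | a , [] , refl , refl = LP.++-identityʳ a
  ... | x ∷ a , y ∷ b , refl , refl with sc | sc′
  ...   | wcons ex _ , (x∉ ∷ _) , _ | wcons ey _ , _ , _ =
    ⊥-elim (All.lookup x∉ (∈-map⁺ src (∈-++⁺ʳ a (here refl))) (trans ex (sym ey)))

  -- The simple cycle at q, or [] if there is none.
  cycleAt : Fin nQ → List (Fin nΔ)
  cycleAt q with em {∃ (SimpleCycleAt q)}
  ... | yes (C , _) = C
  ... | no _        = []

  cycleAt-simple : ∀ {q} → cycleAt q ≢ [] → SimpleCycleAt q (cycleAt q)
  cycleAt-simple {q} Cq≢[] with em {∃ (SimpleCycleAt q)}
  ... | yes (_ , sc) = sc
  ... | no _         = ⊥-elim (Cq≢[] refl)

  cycleAt-unique : ∀ {q C} → SimpleCycleAt q C → cycleAt q ≡ C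
  cycleAt-unique {q} sc with em {∃ (SimpleCycleAt q)}
  ... | yes (_ , sc′) = simpleCycle-unique sc′ sc
  ... | no ∄sc        = ⊥-elim (∄sc (_ , sc))

  cycle-rotation : ∀ {q p} → SimpleCycleAt q (cycleAt q) → SimpleCycleAt p (cycleAt p) →
    p ∈ map src (cycleAt q) →
    ∃₂ λ a b → cycleAt p ≡ a ++ b × cycleAt q ≡ b ++ a × Walk q b p × a ≢ []
  cycle-rotation {q} {p} scq scp p∈Cq
    with flat p (cycleAt p) (cycleAt q) (simpleCycle-isSimpleCycle scp)
              (simpleCycle-isSimpleCycle scq) (simpleCycle-∈ scp) p∈Cq
  ... | [] , [] , Cp≡[] , _ = ⊥-elim (proj₂ (proj₂ scp) Cp≡[])
  ... | [] , t ∷ b , Cp≡ , Cq≡ =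
    t ∷ b , [] , trans Cp≡ (sym (LP.++-identityʳ _)) , Cq≡′ , subst (Walk q []) q≡p wnil , (λ ())
    where
    Cq≡′ : cycleAt q ≡ t ∷ b
    Cq≡′ = trans Cq≡ (LP.++-identityʳ _)
    q≡p : q ≡ p
    q≡p with wcons eq _ ← subst (λ l → Walk q l q) Cq≡′ (proj₁ scq)
           | wcons ep _ ← subst (λ l → Walk p l p) Cp≡ (proj₁ scp) = trans (sym eq) ep
  ... | a₀ ∷ a , b , Cp≡ , Cq≡
    with _ , wb , wcons ea _ ← walk-++⁻ b (subst (λ l → Walk q l q) Cq≡ (proj₁ scq))
       | wcons ea′ _ ← subst (λ l → Walk p l p) Cp≡ (proj₁ scp) =
    a₀ ∷ a , b , Cp≡ , Cq≡ , subst (Walk q b) (trans (sym ea) ea′) wb , (λ ())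

  rotation-∈ : ∀ {x} {C C′ : List (Fin nΔ)} A B → C ≡ A ++ B → C′ ≡ B ++ A →
               x ∈ map src C → x ∈ map src C′
  rotation-∈ A B refl refl x∈ with t , t∈ , refl ← ∈-map⁻ src x∈ =
    ∈-map⁺ src (AnyP.++-comm A B t∈)

  -- Inserting the rotation a ++ b of a simple cycle C = b ++ a into a power of
  -- C, at a point where the walk is in the state p reached by b, gives the
  -- next power of C.  (The insertion point is a copy of the prefix b.)
  insert-rotation : ∀ k {q p} X Z C a b → Unique (map src C) → Walk q C q → C ≡ b ++ a →
    Walk q b p → a ≢ [] → rep S (suc k) C ≡ X ++ Z → Walk q X p → Z ≢ [] →
    X ++ (a ++ b) ++ Z ≡ rep S (suc (suc k)) C
  insert-rotation k {q} X Z C a b u wC C≡ba wb a≢[] Cᵏ⁺¹≡ wX Z≢[]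
    with ++-compare X Z C (rep S k C) (sym Cᵏ⁺¹≡)
  insert-rotation zero X Z C a b u wC C≡ba wb a≢[] Cᵏ⁺¹≡ wX Z≢[] | inj₁ (M , _ , []≡MZ) =
    ⊥-elim (Z≢[] (LP.++-conicalʳ M Z (sym []≡MZ)))
  insert-rotation (suc k) X Z C a b u wC C≡ba wb a≢[] Cᵏ⁺¹≡ wX Z≢[] | inj₁ (M , refl , Cᵏ≡MZ)
    with _ , wC′ , wM ← walk-++⁻ C wX
    with refl ← walk-end-unique wC′ wC = begin
      (C ++ M) ++ (a ++ b) ++ Z ≡⟨ LP.++-assoc C M _ ⟩
      C ++ M ++ (a ++ b) ++ Z   ≡⟨ cong (C ++_) (insert-rotation k M Z C a b u wC C≡ba wb a≢[] Cᵏ≡MZ wM Z≢[]) ⟩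
      C ++ rep S (suc (suc k)) C ∎
    where open ≡-Reasoning
  insert-rotation k X Z C [] b u wC C≡ba wb a≢[] Cᵏ⁺¹≡ wX Z≢[] | inj₂ _ = ⊥-elim (a≢[] refl)
  insert-rotation k X Z C (a₀ ∷ a) b u wC C≡ba wb a≢[] Cᵏ⁺¹≡ wX Z≢[] | inj₂ (y , M , C≡ , refl)
    with refl ← prefix-unique X b y a₀ M a u wC C≡ C≡ba wX wb
    with refl ← LP.++-cancelˡ X (y ∷ M) (a₀ ∷ a) (trans (sym C≡) C≡ba) = begin
      X ++ (Y ++ X) ++ Y ++ R   ≡⟨ cong (X ++_) (LP.++-assoc Y X _) ⟩
      X ++ Y ++ X ++ Y ++ R     ≡⟨ LP.++-assoc X Y _ ⟨
      (X ++ Y) ++ X ++ Y ++ R   ≡⟨ cong ((X ++ Y) ++_) (LP.++-assoc X Y R) ⟨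
      (X ++ Y) ++ (X ++ Y) ++ R ≡⟨ cong (λ l → l ++ l ++ R) C≡ ⟨
      C ++ C ++ R ∎
    where open ≡-Reasoning
          Y = y ∷ M
          R = rep S k C

  splice-cycle : ∀ {q p} X Z k → Walk q X p → Walk p Z q → Z ≢ [] →
    X ++ Z ≡ rep S (suc k) (cycleAt q) → cycleAt p ≢ [] →
    ∀ j → X ++ rep S j (cycleAt p) ++ Z ≡ rep S (suc (j + k)) (cycleAt q)
  splice-cycle {q} {p} X Z k wX wZ Z≢[] XZ≡ Cp≢[] = go
    where
    Cq = cycleAt q
    Cp = cycleAt p
    scq : SimpleCycleAt q Cq
    scq = cycleAt-simple (power-nonempty k (λ e → ++-nonempty X Z≢[] (trans XZ≡ e)))
    scp : SimpleCycleAt p Cp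
    scp = cycleAt-simple Cp≢[]
    -- p is the source of the first transition of Z, which lies on Cq.
    p∈Cq : ∀ Z′ → Walk p Z′ q → Z′ ≢ [] → X ++ Z′ ≡ rep S (suc k) Cq → p ∈ map src Cq
    p∈Cq []      _            Z′≢[] _    = ⊥-elim (Z′≢[] refl)
    p∈Cq (z ∷ _) (wcons ez _) _     XZ′≡ =
      subst (_∈ map src Cq) ez
        (∈-map⁺ src (∈-power (suc k) Cq (subst (z ∈_) XZ′≡ (∈-++⁺ʳ X (here refl)))))
    go : ∀ j → X ++ rep S j Cp ++ Z ≡ rep S (suc (j + k)) Cq
    go zero = XZ≡
    go (suc j) with a , b , Cp≡ab , Cq≡ba , wb , a≢[] ← cycle-rotation scq scp (p∈Cq Z wZ Z≢[] XZ≡) = begin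
      X ++ (Cp ++ rep S j Cp) ++ Z   ≡⟨ cong (X ++_) (LP.++-assoc Cp _ Z) ⟩
      X ++ Cp ++ (rep S j Cp ++ Z)   ≡⟨ cong (λ l → X ++ l ++ (rep S j Cp ++ Z)) Cp≡ab ⟩
      X ++ (a ++ b) ++ rep S j Cp ++ Z
        ≡⟨ insert-rotation (j + k) X (rep S j Cp ++ Z) Cq a b (proj₁ (proj₂ scq)) (proj₁ scq)
             Cq≡ba wb a≢[] (sym (go j)) wX (++-nonempty (rep S j Cp) Z≢[]) ⟩
      rep S (suc (suc (j + k))) Cq ∎
      where open ≡-Reasoning

  detour-shorter : ∀ {N} (X Y Z : List (Fin nΔ)) → length (X ++ Y ++ Z) ≤ N → Y ≢ [] → Z ≢ [] →
                   length Y < N × length (X ++ Z) < N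
  detour-shorter {N} X Y Z len≤ Y≢[] Z≢[] =
    NP.≤-trans (NP.≤-trans (NP.m<m+n (length Y) (length-pos Z≢[])) (NP.m≤n+m _ (length X))) len≤′ ,
    subst (_< N) (sym (LP.length-++ X))
      (NP.≤-trans (NP.+-monoʳ-< (length X) (NP.m<n+m (length Z) (length-pos Y≢[]))) len≤′)
    where
    len≤′ : length X + (length Y + length Z) ≤ N
    len≤′ = subst (_≤ N) (trans (LP.length-++ X) (cong (length X +_) (LP.length-++ Y))) len≤

  -- By induction on the length:
  -- a walk with distinct sources is the cycle itself; otherwise remove a detour
  -- Y at some p, and splice its power of the cycle at p back in.
  closedWalk-power : ∀ N {q} W → length W < N → Walk q W q → W ≢ [] →
                     ∃ λ k → W ≡ rep S (suc k) (cycleAt q)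
  closedWalk-power (suc N) {q} W len< w W≢[] with distinct-or-detour W w
  ... | inj₁ u = 0 , trans (sym (cycleAt-unique (w , u , W≢[]))) (sym (LP.++-identityʳ _))
  ... | inj₂ (detour {X} {Y} {Z} refl wX wY wZ Y≢[] Z≢[])
    with |Y|<N , |XZ|<N ← detour-shorter X Y Z (NP.≤-pred len<) Y≢[] Z≢[]
    with k₁ , Y≡ ← closedWalk-power N Y |Y|<N wY Y≢[]
       | k₂ , XZ≡ ← closedWalk-power N (X ++ Z) |XZ|<N (walk-++ wX wZ) (++-nonempty X Z≢[]) =
    suc k₁ + k₂ ,
    trans (cong (λ l → X ++ l ++ Z) Y≡)
          (splice-cycle X Z k₂ wX wZ Z≢[] XZ≡ (power-nonempty k₁ (λ e → Y≢[] (trans Y≡ e))) (suc k₁))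

module Languages {n : ℕ} (S : CounterSystem n) where
  open CounterSystem S

  startsWith-cong : ∀ xs {u v : ℕ → Fin nΔ} → (∀ i → u i ≡ v i) →
                    StartsWith S xs u → StartsWith S xs v
  startsWith-cong xs u≗v sw i = trans (sym (u≗v (toℕ i))) (sw i)

  inLang-cong : ∀ B p l {u v : ℕ → Fin nΔ} → (∀ i → u i ≡ v i) → InLang S B p l u → InLang S B p l v
  inLang-cong [] p l u≗v (sw , per) =
    startsWith-cong p u≗v sw , λ m → startsWith-cong l (λ i → u≗v (length p + m * length l + i)) (per m)
  inLang-cong ((p₁ , l₁) ∷ ps) p l u≗v (m , m≥1 , sw , rest) =
    m , m≥1 , startsWith-cong (p₁ ++ rep S m l₁) u≗v sw ,
    inLang-cong ps p l (λ i → u≗v (length (p₁ ++ rep S m l₁) + i)) rest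

-- Each position a either has a last visit L ≥ a (a position of the same
-- state after which that state never occurs again), or its state recurs
-- forever; in the latter case w continues periodically with the cycle of
-- that state.  Following last visits gives a decomposition of w whose
-- positions have pairwise distinct states, hence at most |Q| of them.
module InfinitePath {n : ℕ} (S : CounterSystem n) (em : ExcludedMiddle 0ℓ) (flat : Flat S)
                    (w : ℕ → Fin (CounterSystem.nΔ S))
                    (step : ∀ i → CounterSystem.tgt S (w i) ≡ CounterSystem.src S (w (suc i))) where
  open CounterSystem S
  open Walks S
  open Cycles S em flat

  state : ℕ → Fin nQ
  state i = src (w i)

  segment : ℕ → ℕ → List (Fin nΔ)
  segment a zero    = []
  segment a (suc k) = w a ∷ segment (suc a) k

  length-segment : ∀ a k → length (segment a k) ≡ k
  length-segment a zero    = refl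
  length-segment a (suc k) = cong suc (length-segment (suc a) k)

  segment-walk : ∀ a k → Walk (state a) (segment a k) (state (a + k))
  segment-walk a zero    = subst (λ z → Walk (state a) [] (state z)) (sym (NP.+-identityʳ a)) wnil
  segment-walk a (suc k) =
    wcons refl (subst (λ z → Walk z (segment (suc a) k) (state (a + suc k))) (sym (step a))
                 (subst (λ z → Walk (state (suc a)) (segment (suc a) k) (state z))
                        (sym (NP.+-suc a k)) (segment-walk (suc a) k)))

  segment-++ : ∀ a x y → segment a (x + y) ≡ segment a x ++ segment (a + x) y
  segment-++ a zero    y = cong (λ z → segment z y) (sym (NP.+-identityʳ a))
  segment-++ a (suc x) y = cong (w a ∷_)
    (trans (segment-++ (suc a) x y) (cong (λ z → segment (suc a) x ++ segment z y) (sym (NP.+-suc a x))))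

  segment-startsWith : ∀ a k → StartsWith S (segment a k) (shift S a w)
  segment-startsWith a (suc k) F.zero    = cong w (NP.+-identityʳ a)
  segment-startsWith a (suc k) (F.suc i) = trans (cong w (NP.+-suc a (toℕ i))) (segment-startsWith (suc a) k i)

  segment-∈ : ∀ {x} a k → x ∈ segment a k → ∃ λ i → i < k × w (a + i) ≡ x
  segment-∈ a (suc k) (here refl) = 0 , s≤s z≤n , cong w (NP.+-identityʳ a)
  segment-∈ a (suc k) (there x∈) with i , i<k , eq ← segment-∈ (suc a) k x∈ =
    suc i , s≤s i<k , trans (cong w (NP.+-suc a i)) eq

  LastVisit : ℕ → Set
  LastVisit i = ∀ j → i < j → state j ≢ state i

  HasLastVisit : ℕ → Set
  HasLastVisit a = ∃ λ L → a ≤ L × state L ≡ state a × LastVisit L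

  Recurrent : Fin nQ → Set
  Recurrent q = ∀ k → ∃ λ j → k ≤ j × state j ≡ q

  ≤⇒+suc : ∀ {a j} → suc a ≤ j → ∃ λ d → j ≡ a + suc d
  ≤⇒+suc {a} a<j with d , eq ← NP.m≤n⇒∃[o]m+o≡n a<j = d , trans (sym eq) (sym (NP.+-suc a d))

  return-power : ∀ a d → state (a + suc d) ≡ state a →
                 ∃ λ k → segment a (suc d) ≡ rep S (suc k) (cycleAt (state a))
  return-power a d return = closedWalk-power (suc (suc d)) (segment a (suc d))
    (subst (_< suc (suc d)) (sym (length-segment a (suc d))) NP.≤-refl)
    (subst (Walk (state a) (segment a (suc d))) return (segment-walk a (suc d))) (λ ())

  return-cycle : ∀ a d → state (a + suc d) ≡ state a → SimpleCycleAt (state a) (cycleAt (state a))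
  return-cycle a d return with k , eq ← return-power a d return =
    cycleAt-simple (power-nonempty k (λ e → segment≢[] (trans eq e)))
    where segment≢[] : segment a (suc d) ≢ []
          segment≢[] ()

  -- If the state at a does not occur from a + d on, its last occurrence
  -- before a + d is a last visit.
  lastVisit-search : ∀ d a → (∀ j → a + d ≤ j → state j ≢ state a) → HasLastVisit a
  lastVisit-search zero    a absent = ⊥-elim (absent a (NP.≤-reflexive (NP.+-identityʳ a)) refl)
  lastVisit-search (suc d) a absent with state (a + d) F.≟ state a
  ... | yes eq = a + d , NP.m≤m+n a d , eq ,
          λ j a+d<j eq′ → absent j (subst (_≤ j) (sym (NP.+-suc a d)) a+d<j) (trans eq′ eq)
  ... | no neq = lastVisit-search d a absent′
    where
    absent′ : ∀ j → a + d ≤ j → state j ≢ state a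
    absent′ j a+d≤j with NP.m≤n⇒m<n∨m≡n a+d≤j
    ... | inj₁ a+d<j = absent j (subst (_≤ j) (sym (NP.+-suc a d)) a+d<j)
    ... | inj₂ refl  = neq

  recurrent : ∀ a → ¬ HasLastVisit a → Recurrent (state a)
  recurrent a ¬last k with em {∃ λ j → k ≤ j × state j ≡ state a}
  ... | yes later = later
  ... | no ¬later = ⊥-elim (¬last (lastVisit-search k a
                      (λ j k+a≤j eq → ¬later (j , NP.≤-trans (NP.m≤n+m k a) k+a≤j , eq))))

  recurrent-cycle : ∀ a → Recurrent (state a) →
    state (a + length (cycleAt (state a))) ≡ state a × segment a (length (cycleAt (state a))) ≡ cycleAt (state a)
  recurrent-cycle a rec
    with j , a<j , return ← rec (suc a)
    with d , refl ← ≤⇒+suc a<j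
    with k , seg≡ ← return-power a d return = end≡ , seg≡C
    where
    C = cycleAt (state a)
    lengths : suc d ≡ length C + length (rep S k C)
    lengths = trans (sym (length-segment a (suc d))) (trans (cong length seg≡) (LP.length-++ C))
    seg≡C : segment a (length C) ≡ C
    seg≡C = ++-cancel-length (segment a (length C)) C (length-segment a (length C))
      (trans (sym (segment-++ a (length C) (length (rep S k C)))) (trans (cong (segment a) (sym lengths)) seg≡))
    end≡ : state (a + length C) ≡ state a
    end≡ = walk-end-unique (subst (λ l → Walk (state a) l (state (a + length C))) seg≡C (segment-walk a (length C)))
                           (proj₁ (return-cycle a d return))

  module Periodic (a : ℕ) (rec : Recurrent (state a)) where
    C = cycleAt (state a)
    c = length C

    private
      around : ∀ a′ → state a′ ≡ state a → state (a′ + c) ≡ state a × segment a′ c ≡ C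
      around a′ eq = subst (λ q → state (a′ + length (cycleAt q)) ≡ q × segment a′ (length (cycleAt q)) ≡ cycleAt q) eq
        (recurrent-cycle a′ (λ k → let (j , k≤j , eqj) = rec k in j , k≤j , trans eqj (sym eq)))

    periodic-state : ∀ m → state (a + m * c) ≡ state a
    periodic-state zero    = cong state (NP.+-identityʳ a)
    periodic-state (suc m) =
      trans (cong state (sym (trans (NP.+-assoc a (m * c) c) (cong (a +_) (NP.+-comm (m * c) c)))))
            (proj₁ (around (a + m * c) (periodic-state m)))

    periodic : ∀ m → segment (a + m * c) c ≡ C
    periodic m = proj₂ (around (a + m * c) (periodic-state m))

  -- Between a and L, w runs around the cycle at
  -- that state some number of times (possibly zero), then leaves it via w(L).
  lastVisits : ℕ → ℕ → List (ℕ × ℕ)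
  lastVisits f       a with em {HasLastVisit a}
  lastVisits f       a | no _            = []
  lastVisits zero    a | yes (L , _)     = (a , L) ∷ []
  lastVisits (suc f) a | yes (L , _)     = (a , L) ∷ lastVisits f (suc L)

  Visit : ℕ × ℕ → Set
  Visit (a′ , L) = a′ ≤ L × state L ≡ state a′ × LastVisit L

  lastVisits-visit : ∀ f a → All (λ v → a ≤ proj₁ v × Visit v) (lastVisits f a)
  lastVisits-visit f       a with em {HasLastVisit a}
  lastVisits-visit f       a | no _ = []
  lastVisits-visit zero    a | yes (L , a≤L , eq , last) = (NP.≤-refl , a≤L , eq , last) ∷ []
  lastVisits-visit (suc f) a | yes (L , a≤L , eq , last) =
    (NP.≤-refl , a≤L , eq , last) ∷
    All.map (λ (L<a′ , v) → NP.≤-trans a≤L (NP.≤-trans (NP.n≤1+n L) L<a′) , v) (lastVisits-visit f (suc L))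

  lastVisits-increasing : ∀ f a → AllPairs (λ v v′ → proj₂ v < proj₂ v′) (lastVisits f a)
  lastVisits-increasing f       a with em {HasLastVisit a}
  lastVisits-increasing f       a | no _ = []
  lastVisits-increasing zero    a | yes _ = [] ∷ []
  lastVisits-increasing (suc f) a | yes (L , _) =
    All.map (λ (L<a′ , a′≤L′ , _) → NP.≤-trans L<a′ a′≤L′) (lastVisits-visit f (suc L)) ∷
    lastVisits-increasing f (suc L)

  lastVisits-distinct : ∀ f a → Unique (map (λ v → state (proj₂ v)) (lastVisits f a))
  lastVisits-distinct f a =
    APP.map⁺ (distinct (lastVisits f a) (All.map proj₂ (lastVisits-visit f a)) (lastVisits-increasing f a))
    where
    distinct : ∀ vs → All Visit vs → AllPairs (λ v v′ → proj₂ v < proj₂ v′) vs →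
               AllPairs (λ v v′ → state (proj₂ v) ≢ state (proj₂ v′)) vs
    distinct []       []        []        = []
    distinct (v ∷ vs) (vv ∷ vvs) (v< ∷ v<s) =
      All.map (λ lt eq → proj₂ (proj₂ vv) _ lt (sym eq)) v< ∷ distinct vs vvs v<s

  -- The decomposition of w from position 0; fuel |Q| suffices by pigeonhole.
  visits : List (ℕ × ℕ)
  visits = lastVisits nQ 0

  visits-visit : ∀ {v} → v ∈ visits → Visit v
  visits-visit v∈ = proj₂ (All.lookup (lastVisits-visit nQ 0) v∈)

  visits-unique : ∀ {v v′} → v ∈ visits → v′ ∈ visits → state (proj₂ v) ≡ state (proj₂ v′) → v ≡ v′
  visits-unique v∈ v′∈ eq with ∈-AllPairs₂ (lastVisits-increasing nQ 0) v∈ v′∈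
  ... | inj₁ v≡v′        = v≡v′
  ... | inj₂ (inj₁ v<v′) = ⊥-elim (proj₂ (proj₂ (visits-visit v∈)) _ v<v′ (sym eq))
  ... | inj₂ (inj₂ v′<v) = ⊥-elim (proj₂ (proj₂ (visits-visit v′∈)) _ v′<v eq)

  visits-length : length visits ≤ nQ
  visits-length = subst (_≤ nQ) (LP.length-map _ visits) (unique-length≤ _ (lastVisits-distinct nQ 0))

  leaving : List (ℕ × ℕ) → List (Fin nΔ)
  leaving = map (λ v → w (proj₂ v))

  lastVisits-walk : ∀ f a → ∃ λ z → a ≤ z × Walk (state a) (leaving (lastVisits f a)) (state z)
                                  × All (λ v → proj₂ v < z) (lastVisits f a)
  lastVisits-walk f       a with em {HasLastVisit a}
  lastVisits-walk f       a | no _ = a , NP.≤-refl , wnil , []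
  lastVisits-walk zero    a | yes (L , a≤L , eq , _) =
    suc L , NP.≤-trans a≤L (NP.n≤1+n L) ,
    wcons eq (subst (λ q → Walk q [] (state (suc L))) (sym (step L)) wnil) , NP.≤-refl ∷ []
  lastVisits-walk (suc f) a | yes (L , a≤L , eq , _)
    with z , L<z , wk , below ← lastVisits-walk f (suc L) =
    z , NP.≤-trans a≤L (NP.≤-trans (NP.n≤1+n L) L<z) ,
    wcons eq (subst (λ q → Walk q (leaving (lastVisits f (suc L))) (state z)) (sym (step L)) wk) ,
    L<z ∷ below

  -- The transitions by which w leaves a state for good (the stem), and
  -- those among them preceded by a run around the cycle of their source.
  IsStem : Fin nΔ → Set
  IsStem t = Any (λ v → w (proj₂ v) ≡ t) visits

  AfterLoop : Fin nΔ → Set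
  AfterLoop t = Any (λ v → w (proj₂ v) ≡ t × proj₁ v < proj₂ v) visits

  afterLoop⇒stem : ∀ {t} → AfterLoop t → IsStem t
  afterLoop⇒stem = Any.map proj₁

  -- A stem transition t = w(L) differs from w(L + 1), which leaves another state.
  stem-has-other : ∀ {t} → IsStem t → ∃ λ u → u ≢ t
  stem-has-other stem with (a , L) , v∈ , refl ← find stem =
    w (suc L) , λ eq → proj₂ (proj₂ (visits-visit v∈)) (suc L) NP.≤-refl (cong src eq)

  -- The leaving transitions of the decomposition form a simple segment that is
  -- not a loop (or is empty): their sources are distinct and never revisited.
  leaving-simple : ∀ vs {q} z → Walk q (leaving vs) (state z) → All (λ v → proj₂ v < z) vs →
    All Visit vs → Unique (map (λ v → state (proj₂ v)) vs) →
    leaving vs ≡ [] ⊎ IsSimpleNonLoop S (leaving vs)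
  leaving-simple []               z _  _             _ _ = inj₁ refl
  leaving-simple ((a′ , L) ∷ vs) z wk (L<z ∷ below) ((_ , _ , last) ∷ _) u =
    inj₂ ((walk-consecutive wk , UP.map⁻ (subst Unique (LP.map-∘ {g = src} ((a′ , L) ∷ vs)) u)) ,
          λ eq → last z L<z (sym (trans eq (walk-last wk))))

  CycleFrom : ℕ → List (Fin nΔ) → Set
  CycleFrom a C = ∃ λ b → a ≤ b × ∃ λ d → state (b + suc d) ≡ state b × C ≡ cycleAt (state b)

  cycleFrom-weaken : ∀ {a a′ C} → a′ ≤ a → CycleFrom a C → CycleFrom a′ C
  cycleFrom-weaken a′≤a (b , a≤b , rest) = b , NP.≤-trans a′≤a a≤b , rest

  cycleFrom-isLoop : ∀ {a C} → CycleFrom a C → IsLoop S C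
  cycleFrom-isLoop (b , _ , d , return , refl) = simpleCycle-isLoop (return-cycle b d return)

  -- A cycle traversed before a last visit is disjoint from every cycle
  -- traversed later: by flatness, sharing a transition would put the state at
  -- a on the later cycle, so w would revisit it after its last visit.
  cycle-disjoint : ∀ a d → state (a + suc d) ≡ state a → LastVisit (a + suc d) →
    ∀ {C′} → CycleFrom (suc (a + suc d)) C′ → Disjoint S (cycleAt (state a)) C′
  cycle-disjoint a d return last (b , later , d′ , return′ , refl) {x} x∈C x∈C′
    with A , B , C≡AB , C′≡BA ← flat (src x) _ _ (simpleCycle-isSimpleCycle (return-cycle a d return))
                                  (simpleCycle-isSimpleCycle (return-cycle b d′ return′))
                                  (∈-map⁺ src x∈C) (∈-map⁺ src x∈C′)
    with y , y∈C′ , sa≡ ← ∈-map⁻ src (rotation-∈ A B C≡AB C′≡BA (simpleCycle-∈ (return-cycle a d return)))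
    with k , seg≡ ← return-power b d′ return′
    with i , _ , wbi≡y ← segment-∈ b (suc d′) (subst (y ∈_) (sym seg≡) (∈-++⁺ˡ y∈C′)) =
    last (b + i) (NP.≤-trans later (NP.m≤m+n b i)) (trans (cong src wbi≡y) (trans (sym sa≡) (sym return)))

-- Reading a path schema off two sets of transitions, given by their
-- characteristic functions: the stem transitions (taken to leave a state for
-- good) and, among them, those taken after running around the cycle of their
-- source.
module Decoder {n : ℕ} (S : CounterSystem n) (em : ExcludedMiddle 0ℓ) (flat : Flat S)
               (stemBit loopBit : Fin (CounterSystem.nΔ S) → Bool) where
  open CounterSystem S
  open Cycles S em flat using (cycleAt)

  stemIn : Fin nQ → List (Fin nΔ) → Maybe (Fin nΔ)
  stemIn q []       = nothing
  stemIn q (t ∷ ts) with stemBit t | src t F.≟ q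
  ... | true  | yes _ = just t
  ... | true  | no _  = stemIn q ts
  ... | false | _     = stemIn q ts

  stemIn-just : ∀ q t₀ ts → (∀ t → stemBit t ≡ true → src t ≡ q → t ≡ t₀) → t₀ ∈ ts →
                stemBit t₀ ≡ true → src t₀ ≡ q → stemIn q ts ≡ just t₀
  stemIn-just q t₀ (t ∷ ts) only t₀∈ bit₀ src₀ with stemBit t in bit | src t F.≟ q
  ... | true  | yes src-t = cong just (only t bit src-t)
  stemIn-just q t₀ (t ∷ ts) only (here refl) bit₀ src₀ | true | no src-t = ⊥-elim (src-t src₀)
  stemIn-just q t₀ (t ∷ ts) only (there t₀∈) bit₀ src₀ | true | no _ = stemIn-just q t₀ ts only t₀∈ bit₀ src₀
  stemIn-just q t₀ (t ∷ ts) only (here refl) bit₀ src₀ | false | _ with () ← trans (sym bit) bit₀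
  stemIn-just q t₀ (t ∷ ts) only (there t₀∈) bit₀ src₀ | false | _ = stemIn-just q t₀ ts only t₀∈ bit₀ src₀

  stemIn-nothing : ∀ q ts → (∀ t → stemBit t ≡ true → src t ≢ q) → stemIn q ts ≡ nothing
  stemIn-nothing q []       none = refl
  stemIn-nothing q (t ∷ ts) none with stemBit t in bit | src t F.≟ q
  ... | true  | yes src-t = ⊥-elim (none t bit src-t)
  ... | true  | no _      = stemIn-nothing q ts none
  ... | false | _         = stemIn-nothing q ts none

  stemAt : Fin nQ → Maybe (Fin nΔ)
  stemAt q = stemIn q (L.allFin nΔ)

  prependLoop : List (Fin nΔ) × List (Fin nΔ) → PathSchema S → PathSchema S
  prependLoop pl P = schema (pl ∷ body P) (pk P) (lk P)

  -- decode f q acc: the schema read from state q with fuel f, where acc is the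
  -- stem read since the last inserted cycle.
  mutual
    decode : ℕ → Fin nQ → List (Fin nΔ) → PathSchema S
    decode f q acc = decodeStem f q acc (stemAt q)

    decodeStem : ℕ → Fin nQ → List (Fin nΔ) → Maybe (Fin nΔ) → PathSchema S
    decodeStem f       q acc nothing  = schema [] acc (cycleAt q)
    decodeStem zero    q acc (just t) = schema [] [] []   -- out of fuel: never reached
    decodeStem (suc f) q acc (just t) = decodeLeave f q acc t (loopBit t)

    decodeLeave : ℕ → Fin nQ → List (Fin nΔ) → Fin nΔ → Bool → PathSchema S
    decodeLeave f q acc t true  = prependLoop (acc , cycleAt q) (decode f (tgt t) (t ∷ []))
    decodeLeave f q acc t false = decode f (tgt t) (acc ++ t ∷ [])

module DecoderCorrect {n : ℕ} (S : CounterSystem n) (em : ExcludedMiddle 0ℓ) (flat : Flat S)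
  (w : ℕ → Fin (CounterSystem.nΔ S))
  (step : ∀ i → CounterSystem.tgt S (w i) ≡ CounterSystem.src S (w (suc i)))
  (stemBit loopBit : Fin (CounterSystem.nΔ S) → Bool)
  (stem-bits : ∀ t → stemBit t ≡ true ⇔ InfinitePath.IsStem S em flat w step t)
  (loop-bits : ∀ t → loopBit t ≡ true ⇔ InfinitePath.AfterLoop S em flat w step t) where
  open CounterSystem S
  open Walks S
  open Cycles S em flat
  open Languages S
  open InfinitePath S em flat w step
  open Decoder S em flat stemBit loopBit

  reassoc : ∀ x y z i → x + y + z + i ≡ x + (y + z + i)
  reassoc = solve-∀

  Pending : ℕ → List (Fin nΔ) → ℕ → Set
  Pending j acc a = a ≡ j + length acc × acc ≡ segment j (length acc)

  pending-walk : ∀ {j acc a} → Pending j acc a → Walk (state j) acc (state a)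
  pending-walk {j} {acc} (refl , acc≡) =
    subst (λ l → Walk (state j) l (state (j + length acc))) (sym acc≡) (segment-walk j (length acc))

  pending-startsWith : ∀ {j acc a} → Pending j acc a → StartsWith S acc (shift S j w)
  pending-startsWith {j} {acc} (_ , acc≡) =
    subst (λ l → StartsWith S l (shift S j w)) (sym acc≡) (segment-startsWith j (length acc))

  pending-++ : ∀ {j acc a} k → Pending j acc a → acc ++ segment a k ≡ segment j (length acc + k)
  pending-++ {j} {acc} k (pos , acc≡) =
    trans (cong₂ (λ x y → x ++ segment y k) acc≡ pos) (sym (segment-++ j (length acc) k))

  pending-step : ∀ {j acc a} → Pending j acc a → Pending j (acc ++ w a ∷ []) (suc a)
  pending-step {j} {acc} {a} p@(pos , _) =
    trans (cong suc pos) (trans (sym (NP.+-suc j _)) (cong (j +_) (trans (NP.+-comm 1 _) (sym length≡)))) ,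
    trans (pending-++ 1 p) (cong (segment j) (sym length≡))
    where length≡ : length (acc ++ w a ∷ []) ≡ length acc + 1
          length≡ = LP.length-++ acc

  record Correct (j : ℕ) (acc : List (Fin nΔ)) (a : ℕ) (vs : List (ℕ × ℕ)) (P : PathSchema S) : Set where
    field
      stems≡         : stems S P ≡ acc ++ leaving vs
      skeleton-walk  : ∃ λ z → Walk (state j) (skeleton S P) z
      loops-from     : All (CycleFrom a) (loops S P)
      loops-disjoint : AllPairs (Disjoint S) (loops S P)
      accepts        : _∈L_ S (shift S j w) P
  open Correct

  no-stem-at : ∀ a → ¬ HasLastVisit a → ∀ t → stemBit t ≡ true → src t ≢ state a
  no-stem-at a ¬last t bit src-t
    with (_ , L) , v∈ , refl ← find (Equivalence.to (stem-bits t) bit)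
    with _ , _ , last ← visits-visit v∈
    with L N.<? a
  ... | yes L<a = last a L<a (sym src-t)
  ... | no  L≮a = ¬last (L , NP.≮⇒≥ L≮a , src-t , last)

  only-stem-at : ∀ a L → (a , L) ∈ visits → ∀ t → stemBit t ≡ true → src t ≡ state a → t ≡ w L
  only-stem-at a L v∈ t bit src-t
    with (_ , L′) , v′∈ , refl ← find (Equivalence.to (stem-bits t) bit)
    with _ , L≡a , _ ← visits-visit v∈
    with refl ← visits-unique v′∈ v∈ (trans src-t (sym L≡a)) = refl

  final : ∀ a j acc → Pending j acc a → ¬ HasLastVisit a →
          Correct j acc a [] (schema [] acc (cycleAt (state a)))
  final a j acc p ¬last
    with i , a<i , return ← recurrent a ¬last (suc a)
    with d , refl ← ≤⇒+suc a<i = record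
      { stems≡         = sym (LP.++-identityʳ acc)
      ; skeleton-walk  = state a , walk-++ (pending-walk p) (proj₁ (return-cycle a d return))
      ; loops-from     = (a , NP.≤-refl , d , return , refl) ∷ []
      ; loops-disjoint = [] ∷ []
      ; accepts        = pending-startsWith p , periodic-tail
      }
    where
    open Periodic a (recurrent a ¬last)
    periodic-tail : ∀ m → StartsWith S C (shift S (length acc + m * c) (shift S j w))
    periodic-tail m = startsWith-cong C
      (λ i → cong w (trans (cong (λ x → x + m * c + i) (proj₁ p)) (reassoc j (length acc) (m * c) i)))
      (subst (λ l → StartsWith S l (shift S (a + m * c) w)) (periodic m) (segment-startsWith (a + m * c) c))

  loop-then-leave : ∀ a d j acc vs P → Pending j acc a →
    state (a + suc d) ≡ state a → LastVisit (a + suc d) →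
    Correct (a + suc d) (w (a + suc d) ∷ []) (suc (a + suc d)) vs P →
    Correct j acc a ((a , a + suc d) ∷ vs) (prependLoop (acc , cycleAt (state a)) P)
  loop-then-leave a d j acc vs P p return last IH = record
    { stems≡         = trans (LP.++-assoc acc (concat (map proj₁ (body P))) (pk P)) (cong (acc ++_) (stems≡ IH))
    ; skeleton-walk  = proj₁ (skeleton-walk IH) ,
        subst (λ x → Walk (state j) x (proj₁ (skeleton-walk IH)))
          (sym (trans (LP.++-assoc acc (C ++ flatPairs S (body P)) R)
                      (cong (acc ++_) (LP.++-assoc C (flatPairs S (body P)) R))))
          (walk-++ (pending-walk p)
            (walk-++ (proj₁ (return-cycle a d return))
              (subst (λ q → Walk q (flatPairs S (body P) ++ R) (proj₁ (skeleton-walk IH))) return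
                     (proj₂ (skeleton-walk IH)))))
    ; loops-from     = (a , NP.≤-refl , d , return , refl) ∷
                       All.map (cycleFrom-weaken (NP.≤-trans (NP.m≤m+n a (suc d)) (NP.n≤1+n _))) (loops-from IH)
    ; loops-disjoint = All.map (λ later {t} → cycle-disjoint a d return last later {t}) (loops-from IH) ∷
                       loops-disjoint IH
    ; accepts        = suc k , s≤s z≤n , startsWith-loop ,
                       inLang-cong (body P) (pk P) (lk P) shift≗ (accepts IH)
    }
    where
    C = cycleAt (state a)
    R = pk P ++ lk P
    k = proj₁ (return-power a d return)
    stretch : acc ++ rep S (suc k) C ≡ segment j (length acc + suc d)
    stretch = trans (cong (acc ++_) (sym (proj₂ (return-power a d return)))) (pending-++ (suc d) p)
    startsWith-loop : StartsWith S (acc ++ rep S (suc k) C) (shift S j w)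
    startsWith-loop = subst (λ l → StartsWith S l (shift S j w)) (sym stretch) (segment-startsWith j (length acc + suc d))
    length-stretch : length (acc ++ rep S (suc k) C) ≡ length acc + suc d
    length-stretch = trans (cong length stretch) (length-segment j _)
    shift≗ : ∀ i → shift S (a + suc d) w i ≡ shift S (length (acc ++ rep S (suc k) C)) (shift S j w) i
    shift≗ i = cong w (trans (cong (λ x → x + suc d + i) (proj₁ p))
                 (trans (reassoc j (length acc) (suc d) i) (cong (λ x → j + (x + i)) (sym length-stretch))))

  leave : ∀ a j acc vs P → Correct j (acc ++ w a ∷ []) (suc a) vs P → Correct j acc a ((a , a) ∷ vs) P
  leave a j acc vs P IH = record
    { stems≡         = trans (stems≡ IH) (LP.++-assoc acc (w a ∷ []) _)
    ; skeleton-walk  = skeleton-walk IH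
    ; loops-from     = All.map (cycleFrom-weaken (NP.n≤1+n a)) (loops-from IH)
    ; loops-disjoint = loops-disjoint IH
    ; accepts        = accepts IH
    }

  entry-∈ : ∀ pre {v rest} → visits ≡ pre ++ v ∷ rest → v ∈ visits
  entry-∈ pre suffix = subst (_ ∈_) (sym suffix) (∈-++⁺ʳ pre (here refl))

  read-entry : ∀ pre f {v rest} → visits ≡ pre ++ v ∷ rest → length pre + suc f ≡ nQ →
               visits ≡ (pre ++ v ∷ []) ++ rest × length (pre ++ v ∷ []) + f ≡ nQ
  read-entry pre f suffix fuel =
    trans suffix (sym (LP.++-assoc pre _ _)) ,
    trans (cong (_+ f) (LP.length-++ pre)) (trans (NP.+-assoc (length pre) 1 f) fuel)

  -- The decoder follows the decomposition of w, as long as the fuel (the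
  -- number of entries not yet read) lasts.
  decode-correct : ∀ f a j acc pre → Pending j acc a → visits ≡ pre ++ lastVisits f a →
    length pre + f ≡ nQ → Correct j acc a (lastVisits f a) (decode f (state a) acc)
  decode-correct f a j acc pre p suffix fuel with em {HasLastVisit a}
  ... | no ¬last rewrite stemIn-nothing (state a) (L.allFin nΔ) (no-stem-at a ¬last) = final a j acc p ¬last
  decode-correct zero a j acc pre p suffix fuel | yes _
    with () ← NP.+-cancelˡ-≤ (length pre) 1 0
                (subst₂ _≤_ (trans (cong length suffix) (LP.length-++ pre)) (sym fuel) visits-length)
  decode-correct (suc f) a j acc pre p suffix fuel | yes (L , a≤L , return , last)
    rewrite stemIn-just (state a) (w L) (L.allFin nΔ) (only-stem-at a L (entry-∈ pre suffix)) (∈-allFin (w L))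
              (Equivalence.from (stem-bits (w L)) (Any.map (λ eq → cong (λ v → w (proj₂ v)) (sym eq)) (entry-∈ pre suffix))) return
    with NP.m≤n⇒m<n∨m≡n a≤L
  ... | inj₁ a<L with d , refl ← ≤⇒+suc a<L
    rewrite Equivalence.from (loop-bits (w (a + suc d))) (Any.map (λ { refl → refl , a<L }) (entry-∈ pre suffix))
          | step (a + suc d)
    with suffix′ , fuel′ ← read-entry pre f suffix fuel =
    loop-then-leave a d j acc _ _ p return last
      (decode-correct f (suc (a + suc d)) (a + suc d) (w (a + suc d) ∷ []) (pre ++ (a , a + suc d) ∷ [])
         (NP.+-comm 1 _ , refl) suffix′ fuel′)
  ... | inj₂ refl with loopBit (w a) in bit
  ...   | true with (a′ , L′) , v′∈ , (w≡ , a′<L′) ← find (Equivalence.to (loop-bits (w a)) bit)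
    with refl ← visits-unique v′∈ (entry-∈ pre suffix) (cong src w≡) = ⊥-elim (NP.<-irrefl refl a′<L′)
  ...   | false rewrite step a with suffix′ , fuel′ ← read-entry pre f suffix fuel =
    leave a j acc _ _
      (decode-correct f (suc a) j (acc ++ w a ∷ []) (pre ++ (a , a) ∷ []) (pending-step p) suffix′ fuel′)

  decoded : Correct 0 [] 0 visits (decode nQ (state 0) [])
  decoded = decode-correct nQ 0 0 [] [] (refl , refl) refl refl

  decode-minimal : IsMinimal S (decode nQ (state 0) [])
  decode-minimal with z , _ , wk , below ← lastVisits-walk nQ 0 =
    (All.map cycleFrom-isLoop (loops-from decoded) , walk-consecutive (proj₂ (skeleton-walk decoded))) ,
    subst (λ l → l ≡ [] ⊎ IsSimpleNonLoop S l) (sym (stems≡ decoded))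
      (leaving-simple visits z wk below (All.map proj₂ (lastVisits-visit nQ 0)) (lastVisits-distinct nQ 0)) ,
    loops-disjoint decoded

  decode-accepts : _∈L_ S w (decode nQ (state 0) [])
  decode-accepts = accepts decoded

module Runs {n : ℕ} (S : CounterSystem n) where
  open CounterSystem S

  run-start : ∀ (f : ℕ → Fin nΔ) {c c′} → Run S c (L.applyUpTo f 1) c′ → src (f 0) ≡ proj₁ c
  run-start f (run-cons (src≡ , _) _) = src≡

  run-step : ∀ k (f : ℕ → Fin nΔ) {c c′} → Run S c (L.applyUpTo f (2 + k)) c′ → tgt (f k) ≡ src (f (suc k))
  run-step zero    f (run-cons (_ , _ , _ , tgt≡) (run-cons (src≡ , _) _)) = trans tgt≡ (sym src≡)
  run-step (suc k) f (run-cons _ r) = run-step k (λ i → f (suc i)) r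

  fireable-path : ∀ {c₀} w → Fireable S c₀ w → src (w 0) ≡ proj₁ c₀ × (∀ i → tgt (w i) ≡ src (w (suc i)))
  fireable-path w fire = run-start w (proj₂ (fire 1)) , λ i → run-step i w (proj₂ (fire (2 + i)))

module Candidates {n : ℕ} (S : CounterSystem n) (em : ExcludedMiddle 0ℓ) (flat : Flat S) where
  open CounterSystem S
  open SubsetCodes em

  Code : Set
  Code = Vec (Fin nΔ) nΔ

  codes : List Code
  codes = vectors (L.allFin nΔ) nΔ

  decodeCodes : Fin nQ → Code → Code → PathSchema S
  decodeCodes q stemCode loopCode = Decoder.decode S em flat (_∈ᶜ stemCode) (_∈ᶜ loopCode) nQ q []

  candidates : Fin nQ → List (PathSchema S)
  candidates q = cartesianProductWith (decodeCodes q) codes codes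

  length-candidates : ∀ q → length (candidates q) ≡ nΔ ^ (2 * nΔ)
  length-candidates q = begin
    length (candidates q)      ≡⟨ length-cartesianProductWith (decodeCodes q) codes codes ⟩
    length codes * length codes ≡⟨ cong (λ x → x * x) length-codes ⟩
    nΔ ^ nΔ * nΔ ^ nΔ          ≡⟨ NP.^-distribˡ-+-* nΔ nΔ nΔ ⟨
    nΔ ^ (nΔ + nΔ)             ≡⟨ cong (λ k → nΔ ^ (nΔ + k)) (NP.+-identityʳ nΔ) ⟨
    nΔ ^ (2 * nΔ)              ∎
    where
    open ≡-Reasoning
    length-codes : length codes ≡ nΔ ^ nΔ
    length-codes = trans (length-vectors (L.allFin nΔ) nΔ) (cong (_^ nΔ) (LP.length-tabulate {n = nΔ} (λ i → i)))

  -- Every infinite path from q is accepted by a minimal candidate: the one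
  -- decoded from the codes of the two sets of transitions of its decomposition.
  candidates-cover : ∀ q w → src (w 0) ≡ q → (step : ∀ i → tgt (w i) ≡ src (w (suc i))) →
                     ∃ λ P → P ∈ candidates q × IsMinimal S P × _∈L_ S w P
  candidates-cover q w refl step =
    decodeCodes q stemCode loopCode ,
    ∈-cartesianProductWith⁺ (decodeCodes q) (all-codes stemCode) (all-codes loopCode) ,
    Decoded.decode-minimal , Decoded.decode-accepts
    where
    open InfinitePath S em flat w step
    all-codes : ∀ c → c ∈ codes
    all-codes c = ∈-vectors (L.allFin nΔ) c (λ i → ∈-allFin _)
    -- Both sets consist of stem transitions, which are codable.
    stem-other : ∀ t → IsStem t → ∃ λ u → u ≢ t
    stem-other t = stem-has-other
    loop-other : ∀ t → AfterLoop t → ∃ λ u → u ≢ t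
    loop-other t = stem-has-other ∘ afterLoop⇒stem
    stemCode loopCode : Code
    stemCode = code IsStem stem-other
    loopCode = code AfterLoop loop-other
    module Decoded = DecoderCorrect S em flat w step (_∈ᶜ stemCode) (_∈ᶜ loopCode)
                       (code-correct IsStem stem-other) (code-correct AfterLoop loop-other)

corollary1 : ExcludedMiddle 0ℓ →
    ∀ {n} (S : CounterSystem n) → Flat S → (c₀ : Conf S) →
    Σ (List (PathSchema S)) λ X →
    All (IsMinimal S) X
    × length X ≤ CounterSystem.nΔ S ^ (2 * CounterSystem.nΔ S)
    × (∀ (w : ℕ → T S) →
    Fireable S c₀ w ⇔ (Fireable S c₀ w × Any (λ P → _∈L_ S w P) X))
corollary1 em S flat c₀@(q₀ , _) =
  X , AllP.all-filter minimal? (candidates q₀) ,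
  NP.≤-trans (LP.length-filter minimal? (candidates q₀)) (NP.≤-reflexive (length-candidates q₀)) ,
  λ w → mk⇔ (λ fire → fire , covered w fire) proj₁
  where
  open Candidates S em flat
  minimal? : ∀ P → Dec (IsMinimal S P)
  minimal? P = em
  X : List (PathSchema S)
  X = L.filter minimal? (candidates q₀)
  covered : ∀ w → Fireable S c₀ w → Any (λ P → _∈L_ S w P) X
  covered w fire with start , step ← Runs.fireable-path S w fire
    with P , P∈ , minimal , accepts ← candidates-cover q₀ w start step =
    lose (∈-filter⁺ minimal? P∈ minimal) accepts
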